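{- Let $S$ be a signature and $t_1,t_2$ two $S$-terms with $t_1\to_i t_2$ for some $i\ge2$. Then: (i) $\mathrm{dc}(t_1)=\mathrm{dc}(t_2)$; (ii) $t_1$ and $t_2$ have the same edges except for the parent edge of $i$; (iii) the parent edge of $i$ in $t_1$ is dominated by the parent edge of $i$ in $t_2$; (iv) for any internal nodes $i',i''$, if $i''$ is a descendant of $i'$ in $t_1$ then $i''$ is a descendant of $i'$ in $t_2$.
   Context: A signature is a set $S$ with arity map $|\cdot|:S\to\mathbb N$. An $S$-term is the leaf $\ell$ or $s\,t_1\cdots t_{|s|}$ with $s\in S$ and $S$-terms $t_i$. The preorder traversal visits the root, then the subterms left to right recursively. Internal nodes are numbered $1,\dots,\deg t$ in preorder and identified with these numbers; $\mathrm{dc}(t)$ is the word of their decorations. Children (leaves included) are numbered from $1$ left to right. An edge is a triple $(i_1,j,i_2)$ of internal nodes with $i_2$ the $j$-th child of $i_1$; by convention $(1,0,1)$ is an edge when $\deg t\ge1$. Each internal node $i$ has a unique edge $(i_1,j,i)$, its parent edge. For $i\ge1$, $t_1\to_i t_2$ holds when the internal node $i$ of $t_1$ is visited immediately after some leaf $x$ in the preorder traversal of $t_1$ and $t_2$ is obtained from $t_1$ by detaching the subterm rooted at $i$ (a leaf taking its place) and grafting it in place of $x$. An edge $(i_1,j_1,i)$ is dominated by $(i_2,j_2,i)$ if $(i_1,-j_1)$ is lexicographically smaller than or equal to $(i_2,-j_2)$. -}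

module Defs where

open import Data.Nat using (ℕ; zero; suc; _≤_; _<_)
open import Data.Bool using (Bool; true; false)
open import Data.List using (List; []; _∷_; _++_; map; length)
open import Data.Vec using (Vec; []; _∷_)
open import Data.Maybe using (Maybe; just; nothing)
open import Data.Product using (Σ; _×_; _,_; map₁)
open import Data.Sum using (_⊎_)
open import Relation.Binary.PropositionalEquality using (_≡_)

data Term {S : Set} (ar : S → ℕ) : Set where
  leaf : Term ar
  node : (s : S) → Vec (Term ar) (ar s) → Term ar

-- Positions (paths from the root); child numbers are 1-based.
Pos : Set
Pos = List ℕ

nth : {A : Set} → List A → ℕ → Maybe A
nth [] _ = nothing
nth (x ∷ xs) zero = just x
nth (x ∷ xs) (suc k) = nth xs k

module _ {S : Set} {ar : S → ℕ} where

  mutual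
    nodes : Term ar → List Pos
    nodes leaf = []
    nodes (node s ts) = [] ∷ nodesV 1 ts

    nodesV : {n : ℕ} → ℕ → Vec (Term ar) n → List Pos
    nodesV k [] = []
    nodesV k (t ∷ ts) = map (k ∷_) (nodes t) ++ nodesV (suc k) ts

  mutual
    traversal : Term ar → List (Pos × Bool)
    traversal leaf = ([] , false) ∷ []
    traversal (node s ts) = ([] , true) ∷ traversalV 1 ts

    traversalV : {n : ℕ} → ℕ → Vec (Term ar) n → List (Pos × Bool)
    traversalV k [] = []
    traversalV k (t ∷ ts) = map (map₁ (k ∷_)) (traversal t) ++ traversalV (suc k) ts

  mutual
    dc : Term ar → List S
    dc leaf = []
    dc (node s ts) = s ∷ dcV ts

    dcV : {n : ℕ} → Vec (Term ar) n → List S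
    dcV [] = []
    dcV (t ∷ ts) = dc t ++ dcV ts

  mutual
    subAt : Term ar → Pos → Maybe (Term ar)
    subAt t [] = just t
    subAt leaf (_ ∷ _) = nothing
    subAt (node s ts) (k ∷ p) = subAtV ts k p

    subAtV : {n : ℕ} → Vec (Term ar) n → ℕ → Pos → Maybe (Term ar)
    subAtV [] k p = nothing
    subAtV (t ∷ ts) zero p = nothing
    subAtV (t ∷ ts) (suc zero) p = subAt t p
    subAtV (t ∷ ts) (suc (suc k)) p = subAtV ts (suc k) p

  mutual
    -- replace the subterm at a position (no-op on invalid positions)
    replaceAt : Term ar → Pos → Term ar → Term ar
    replaceAt t [] u = u
    replaceAt leaf (_ ∷ _) u = leaf
    replaceAt (node s ts) (k ∷ p) u = node s (replaceAtV ts k p u)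

    replaceAtV : {n : ℕ} → Vec (Term ar) n → ℕ → Pos → Term ar → Vec (Term ar) n
    replaceAtV [] k p u = []
    replaceAtV (t ∷ ts) zero p u = t ∷ ts
    replaceAtV (t ∷ ts) (suc zero) p u = replaceAt t p u ∷ ts
    replaceAtV (t ∷ ts) (suc (suc k)) p u = t ∷ replaceAtV ts (suc k) p u

  deg : Term ar → ℕ
  deg t = length (nodes t)

  -- position of the internal node numbered i (numbering 1..deg t in preorder)
  nodeAt : Term ar → ℕ → Maybe Pos
  nodeAt t zero = nothing
  nodeAt t (suc i) = nth (nodes t) i

  Edge : Term ar → ℕ → ℕ → ℕ → Set
  Edge t i₁ j i₂ =
    (1 ≤ deg t × i₁ ≡ 1 × j ≡ 0 × i₂ ≡ 1)
    ⊎ (1 ≤ j × Σ Pos λ p → nodeAt t i₁ ≡ just p × nodeAt t i₂ ≡ just (p ++ (j ∷ [])))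

  -- t₁ →_i t₂ : internal node i (at position p) is visited immediately after
  -- the leaf at position x; t₂ detaches the subterm u at p (leaf in its place)
  -- and grafts it in place of x.
  Rot : Term ar → ℕ → Term ar → Set
  Rot t₁ i t₂ =
    Σ ℕ λ k → Σ Pos λ x → Σ Pos λ p → Σ (Term ar) λ u →
      nth (traversal t₁) k ≡ just (x , false)
      × nth (traversal t₁) (suc k) ≡ just (p , true)
      × nodeAt t₁ i ≡ just p
      × subAt t₁ p ≡ just u
      × t₂ ≡ replaceAt (replaceAt t₁ p leaf) x u

  Descendant : Term ar → ℕ → ℕ → Set
  Descendant t i' i'' =
    Σ Pos λ p → Σ Pos λ q → nodeAt t i' ≡ just p × nodeAt t i'' ≡ just (p ++ q)

Dominated : ℕ × ℕ → ℕ × ℕ → Set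
Dominated (i₁ , j₁) (i₂ , j₂) = i₁ < i₂ ⊎ (i₁ ≡ i₂ × j₂ ≤ j₁)

-- Annotate the preorder traversal with positions and decorations; the traversal, the node list
-- and dc are all projections of it. Replacing the subterm at a position p changes the traversal
-- only inside one contiguous block, whose positions are exactly those extending p. Since the leaf
-- x is visited immediately before p, the traversal of t₁ reads  B, x, (subtree at p), A  and that
-- of t₂ reads  B, (the same subtree, now at x), p, A.  So the internal nodes keep their decorations
-- and their preorder numbers, those below p being relocated below x. This relocation maps every
-- edge other than the parent edge of i to an edge, and descendants to descendants because every
-- proper prefix of p is a prefix of x. Finally p = q·(b+1) and x = q·b·r, so the new parent of i
-- is q itself, reached by the smaller child number b, or a proper descendant of q, which comes
-- later in preorder: the old parent edge is dominated by the new one.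

module Submission where

open import Defs
open import Data.Nat using (ℕ; zero; suc; _+_; _≤_; _<_; z≤n; s≤s)
open import Data.Nat.Properties
  using (+-suc; +-identityʳ; m≢1+m+n; m≤m+n; +-monoʳ-<; n≤1+n; <-irrefl; ≤-refl; ≤-trans)
open import Data.Bool using (Bool; true; false)
open import Data.Maybe using (Maybe; just; nothing; is-just)
open import Data.Maybe.Properties using (just-injective)
open import Data.Vec using (Vec; []; _∷_)
open import Data.List using (List; []; _∷_; _++_; _∷ʳ_; map; length; initLast; _∷ʳ′_)
open import Data.List.Properties
  using (++-assoc; ++-identityʳ; ++-cancelˡ; ++-conicalʳ; ∷-injective; ∷-injectiveʳ; ∷ʳ-injective;
         map-++; map-∘; map-id)
open import Data.List.Membership.Propositional using (_∈_)
open import Data.List.Membership.Propositional.Properties using (∈-++⁺ʳ; ∈-++⁻; ∈-map⁻)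
open import Data.List.Relation.Unary.Any using (here; there)
open import Data.List.Relation.Unary.All as All using (All; []; _∷_)
import Data.List.Relation.Unary.All.Properties as All
open import Data.List.Relation.Unary.AllPairs as AllPairs using (AllPairs; []; _∷_)
import Data.List.Relation.Unary.AllPairs.Properties as AllPairs
open import Data.List.Relation.Unary.Unique.Propositional using (Unique)
open import Data.List.Relation.Binary.Pointwise as Pointwise using (Pointwise; []; _∷_)
open import Data.Product using (Σ; ∃; ∃₂; _×_; _,_; proj₁; proj₂; map₁; map₂)
open import Data.Sum using (_⊎_; inj₁; inj₂)
open import Data.Empty using (⊥-elim)
open import Function using (_∘_; id)
open import Relation.Nullary using (¬_)
open import Function.Bundles using (_⇔_; mk⇔)
open import Relation.Binary.PropositionalEquality
  using (_≡_; _≢_; refl; sym; trans; cong; cong₂; subst; subst₂; module ≡-Reasoning)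

module _ {A : Set} where

  nth-∈ : (xs : List A) (n : ℕ) {y : A} → nth xs n ≡ just y → y ∈ xs
  nth-∈ (x ∷ xs) zero    refl = here refl
  nth-∈ (x ∷ xs) (suc n) eq   = there (nth-∈ xs n eq)

  ∈-nth : {xs : List A} {y : A} → y ∈ xs → ∃ λ n → nth xs n ≡ just y
  ∈-nth (here refl)  = zero , refl
  ∈-nth (there y∈xs) with ∈-nth y∈xs
  ... | n , eq = suc n , eq

  nth-length : (xs : List A) (n : ℕ) {y : A} → nth xs n ≡ just y → n < length xs
  nth-length (x ∷ xs) zero    _  = s≤s z≤n
  nth-length (x ∷ xs) (suc n) eq = s≤s (nth-length xs n eq)

  nth-map⁻ : {B : Set} (f : B → A) (xs : List B) (n : ℕ) {y : A} →
    nth (map f xs) n ≡ just y → ∃ λ z → nth xs n ≡ just z × f z ≡ y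
  nth-map⁻ f (x ∷ xs) zero    refl = x , refl , refl
  nth-map⁻ f (x ∷ xs) (suc n) eq   = nth-map⁻ f xs n eq

  nth-++⁻ : (xs ys : List A) (n : ℕ) {y : A} → nth (xs ++ ys) n ≡ just y →
    nth xs n ≡ just y ⊎ ∃ λ m → n ≡ length xs + m × nth ys m ≡ just y
  nth-++⁻ []       ys n       eq = inj₂ (n , refl , eq)
  nth-++⁻ (x ∷ xs) ys zero    eq = inj₁ eq
  nth-++⁻ (x ∷ xs) ys (suc n) eq with nth-++⁻ xs ys n eq
  ... | inj₁ left            = inj₁ left
  ... | inj₂ (m , refl , right) = inj₂ (m , refl , right)

  nth-++-consecutive : (xs ys : List A) (n : ℕ) {y z : A} →
    nth (xs ++ ys) n ≡ just y → nth (xs ++ ys) (suc n) ≡ just z →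
    (nth xs n ≡ just y × nth xs (suc n) ≡ just z)
    ⊎ (nth xs n ≡ just y × nth ys 0 ≡ just z)
    ⊎ ∃ λ m → nth ys m ≡ just y × nth ys (suc m) ≡ just z
  nth-++-consecutive []            ys n       eq eq′ = inj₂ (inj₂ (n , eq , eq′))
  nth-++-consecutive (x ∷ [])      ys zero    eq eq′ = inj₂ (inj₁ (eq , eq′))
  nth-++-consecutive (x ∷ x′ ∷ xs) ys zero    eq eq′ = inj₁ (eq , eq′)
  nth-++-consecutive (x ∷ xs)      ys (suc n) eq eq′ = nth-++-consecutive xs ys n eq eq′

  nth-split : (xs : List A) (n : ℕ) {y : A} → nth xs n ≡ just y →
    ∃₂ λ ys zs → xs ≡ ys ++ y ∷ zs × length ys ≡ n
  nth-split (x ∷ xs) zero    refl = [] , xs , refl , refl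
  nth-split (x ∷ xs) (suc n) eq with nth-split xs n eq
  ... | ys , zs , refl , refl = x ∷ ys , zs , refl , refl

  nth-split₂ : (xs : List A) (n : ℕ) {y z : A} → nth xs n ≡ just y → nth xs (suc n) ≡ just z →
    ∃₂ λ ys zs → xs ≡ ys ++ y ∷ z ∷ zs
  nth-split₂ (x ∷ x′ ∷ xs) zero    refl refl = [] , xs , refl
  nth-split₂ (x ∷ xs)      (suc n) eq   eq′ with nth-split₂ xs n eq eq′
  ... | ys , zs , refl = x ∷ ys , zs , refl

  split-unique : {B : Set} (f : A → B) {l : List A} → AllPairs (λ a b → f a ≢ f b) l →
    (xs xs′ : List A) {y y′ : A} {ys ys′ : List A} →
    l ≡ xs ++ y ∷ ys → l ≡ xs′ ++ y′ ∷ ys′ → f y ≡ f y′ →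
    xs ≡ xs′ × y ≡ y′ × ys ≡ ys′
  split-unique f distinct       []       []        refl refl _ = refl , refl , refl
  split-unique f (y≁ ∷ _)       []       (x ∷ xs′) refl refl eq =
    ⊥-elim (All.lookup y≁ (∈-++⁺ʳ xs′ (here refl)) eq)
  split-unique f (x≁ ∷ _)       (x ∷ xs) []        refl refl eq =
    ⊥-elim (All.lookup x≁ (∈-++⁺ʳ xs (here refl)) (sym eq))
  split-unique f (_ ∷ distinct) (x ∷ xs) (x′ ∷ xs′) refl eq′ eq with ∷-injective eq′
  ... | refl , tail-eq with split-unique f distinct xs xs′ refl tail-eq eq
  ... | refl , refl , refl = refl , refl , refl

  nth-injective : {xs : List A} → Unique xs → (m n : ℕ) {y : A} →
    nth xs m ≡ just y → nth xs n ≡ just y → m ≡ n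
  nth-injective {xs} distinct m n eqm eqn with nth-split xs m eqm | nth-split xs n eqn
  ... | ys , zs , split , refl | ys′ , zs′ , split′ , refl =
    cong length (proj₁ (split-unique id distinct ys ys′ split split′ refl))

  nth-Pointwise : {B : Set} {R : A → B → Set} {xs : List A} {ys : List B} →
    Pointwise R xs ys → (n : ℕ) {x : A} → nth xs n ≡ just x → ∃ λ y → nth ys n ≡ just y × R x y
  nth-Pointwise (r ∷ _)  zero    refl = _ , refl , r
  nth-Pointwise (_ ∷ rs) (suc n) eq   = nth-Pointwise rs n eq

-- Positions

infix 4 _≼_

_≼_ : Pos → Pos → Set
P ≼ Q = ∃ λ r → Q ≡ P ++ r

≼-refl : (P : Pos) → P ≼ P
≼-refl P = [] , sym (++-identityʳ P)

≼-comparable : (P Q R T : Pos) → P ++ R ≡ Q ++ T → P ≼ Q ⊎ Q ≼ P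
≼-comparable []      Q       R T eq = inj₁ (Q , refl)
≼-comparable (a ∷ P) []      R T eq = inj₂ (a ∷ P , refl)
≼-comparable (a ∷ P) (b ∷ Q) R T eq with ∷-injective eq
... | refl , eq′ with ≼-comparable P Q R T eq′
...   | inj₁ (r , refl) = inj₁ (r , refl)
...   | inj₂ (r , refl) = inj₂ (r , refl)

≼-++ : {p P : Pos} (Q : Pos) → p ≼ P → p ≼ P ++ Q
≼-++ {p} Q (r , refl) = r ++ Q , ++-assoc p r Q

∷ʳ≢[] : (P : Pos) {c : ℕ} → P ∷ʳ c ≢ []
∷ʳ≢[] []      ()
∷ʳ≢[] (_ ∷ _) ()

HeadFrom : ℕ → Pos → Set
HeadFrom j P = ∃₂ λ h q → P ≡ h ∷ q × j ≤ h

HeadFrom-++ : {j : ℕ} {P : Pos} (R : Pos) → HeadFrom j P → HeadFrom j (P ++ R)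
HeadFrom-++ R (h , q , refl , j≤h) = h , q ++ R , refl , j≤h

HeadFrom-suc⇒≢ : {j : ℕ} {P Q : Pos} → HeadFrom (suc j) P → P ≢ j ∷ Q
HeadFrom-suc⇒≢ (h , q , refl , j<h) eq = <-irrefl (sym (proj₁ (∷-injective eq))) j<h

InLeftSibling : Pos → Pos → Set
InLeftSibling x p = ∃ λ q → ∃ λ b → ∃ λ r → p ≡ q ∷ʳ suc b × x ≡ q ++ b ∷ r

strict-prefix-of-left-sibling : {x p P : Pos} → InLeftSibling x p → P ≼ p → ¬ p ≼ P → P ≼ x
strict-prefix-of-left-sibling {P = P} (q , b , r , refl , refl) (w , eq) p⋠P with initLast w
... | []       = ⊥-elim (p⋠P (subst (_≼ P) (sym (trans eq (++-identityʳ P))) (≼-refl P)))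
... | w′ ∷ʳ′ c with ∷ʳ-injective q (P ++ w′) (trans eq (sym (++-assoc P w′ (c ∷ []))))
...   | refl , _ = w′ ++ b ∷ r , ++-assoc P w′ (b ∷ r)

-- Relocated p x P P′: P′ is where the node at P ends up when the subtree at p is moved to x.
Relocated : Pos → Pos → Pos → Pos → Set
Relocated p x P P′ = (∃ λ r → P ≡ p ++ r × P′ ≡ x ++ r) ⊎ (P′ ≡ P × ¬ p ≼ P)

relocate : (p x : Pos) {B A : List Pos} → All (λ P → ¬ p ≼ P) B → All (λ P → ¬ p ≼ P) A →
  (M : List Pos) → Pointwise (Relocated p x) (B ++ map (p ++_) M ++ A) (B ++ map (x ++_) M ++ A)
relocate p x outB outA M = Pointwise.++⁺ (fixed outB) (Pointwise.++⁺ (moved M) (fixed outA))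
  where
    fixed : {L : List Pos} → All (λ P → ¬ p ≼ P) L → Pointwise (Relocated p x) L L
    fixed []         = []
    fixed (out ∷ os) = inj₂ (refl , out) ∷ fixed os

    moved : (M : List Pos) → Pointwise (Relocated p x) (map (p ++_) M) (map (x ++_) M)
    moved []      = []
    moved (r ∷ M) = inj₁ (r , refl , refl) ∷ moved M

relocated-moved : {p x r P′ : Pos} → Relocated p x (p ++ r) P′ → P′ ≡ x ++ r
relocated-moved {p} {x} (inj₁ (r′ , eq , refl)) = cong (x ++_) (sym (++-cancelˡ p _ _ eq))
relocated-moved {r = r} (inj₂ (_ , out))        = ⊥-elim (out (r , refl))

relocated-fixed : {p x P P′ : Pos} → ¬ p ≼ P → Relocated p x P P′ → P′ ≡ P
relocated-fixed out (inj₁ (r , refl , _)) = ⊥-elim (out (r , refl))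
relocated-fixed out (inj₂ (eq , _))       = eq

relocated-self : {p x P′ : Pos} → Relocated p x p P′ → P′ ≡ x
relocated-self {p} {x} rel =
  trans (relocated-moved (subst (λ P → Relocated p x P _) (sym (++-identityʳ p)) rel)) (++-identityʳ x)

-- Annotated preorder traversals

-- nothing marks a leaf.
Entry : Set → Set
Entry S = Pos × Maybe S

module _ {S : Set} where

  shift : Pos → List (Entry S) → List (Entry S)
  shift P = map (map₁ (P ++_))

  shape : Entry S → Pos × Bool
  shape = map₂ is-just

  internal : List (Entry S) → List Pos
  internal []                  = []
  internal ((P , just _) ∷ l)  = P ∷ internal l
  internal ((P , nothing) ∷ l) = internal l

  decorations : List (Entry S) → List S
  decorations []                  = []
  decorations ((P , just s) ∷ l)  = s ∷ decorations l
  decorations ((P , nothing) ∷ l) = decorations l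

  DistinctPositions : List (Entry S) → Set
  DistinctPositions = AllPairs (λ e e′ → proj₁ e ≢ proj₁ e′)

  internal-++ : (l l′ : List (Entry S)) → internal (l ++ l′) ≡ internal l ++ internal l′
  internal-++ []                  l′ = refl
  internal-++ ((P , just _) ∷ l)  l′ = cong (P ∷_) (internal-++ l l′)
  internal-++ ((P , nothing) ∷ l) l′ = internal-++ l l′

  internal-shift : (P : Pos) (l : List (Entry S)) → internal (shift P l) ≡ map (P ++_) (internal l)
  internal-shift P []                  = refl
  internal-shift P ((Q , just _) ∷ l)  = cong ((P ++ Q) ∷_) (internal-shift P l)
  internal-shift P ((Q , nothing) ∷ l) = internal-shift P l

  decorations-++ : (l l′ : List (Entry S)) → decorations (l ++ l′) ≡ decorations l ++ decorations l′
  decorations-++ []                  l′ = refl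
  decorations-++ ((P , just s) ∷ l)  l′ = cong (s ∷_) (decorations-++ l l′)
  decorations-++ ((P , nothing) ∷ l) l′ = decorations-++ l l′

  decorations-shift : (P : Pos) (l : List (Entry S)) → decorations (shift P l) ≡ decorations l
  decorations-shift P []                  = refl
  decorations-shift P ((Q , just s) ∷ l)  = cong (s ∷_) (decorations-shift P l)
  decorations-shift P ((Q , nothing) ∷ l) = decorations-shift P l

  internal-shift-++ : (P : Pos) (M A : List (Entry S)) →
    internal (shift P M ++ A) ≡ map (P ++_) (internal M) ++ internal A
  internal-shift-++ P M A = trans (internal-++ (shift P M) A) (cong (_++ internal A) (internal-shift P M))

  decorations-shift-++ : (P : Pos) (M A : List (Entry S)) →
    decorations (shift P M ++ A) ≡ decorations M ++ decorations A
  decorations-shift-++ P M A =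
    trans (decorations-++ (shift P M) A) (cong (_++ decorations A) (decorations-shift P M))

  All-internal : {Q : Pos → Set} (l : List (Entry S)) → All (Q ∘ proj₁) l → All Q (internal l)
  All-internal []                  []       = []
  All-internal ((P , just _) ∷ l)  (q ∷ qs) = q ∷ All-internal l qs
  All-internal ((P , nothing) ∷ l) (_ ∷ qs) = All-internal l qs

  internal-unique : (l : List (Entry S)) → DistinctPositions l → Unique (internal l)
  internal-unique []                  []       = []
  internal-unique ((P , just _) ∷ l)  (d ∷ ds) = All-internal l d ∷ internal-unique l ds
  internal-unique ((P , nothing) ∷ l) (_ ∷ ds) = internal-unique l ds

  ∈-internal : (l : List (Entry S)) {P : Pos} {s : S} → (P , just s) ∈ l → P ∈ internal l
  ∈-internal ((P , just _) ∷ l)  (here refl) = here refl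
  ∈-internal ((P , just _) ∷ l)  (there e∈l) = there (∈-internal l e∈l)
  ∈-internal ((P , nothing) ∷ l) (there e∈l) = ∈-internal l e∈l

  shift-distinct : (P : Pos) {l : List (Entry S)} → DistinctPositions l → DistinctPositions (shift P l)
  shift-distinct P = AllPairs.map⁺ ∘ AllPairs.map (λ ≢ eq → ≢ (++-cancelˡ P _ _ eq))

  Outside : Pos → Entry S → Set
  Outside P e = ¬ (P ≼ proj₁ e)

  shift-outside : {j c : ℕ} (P : Pos) → j ≢ c → (l : List (Entry S)) →
    All (Outside (c ∷ P)) (shift (j ∷ []) l)
  shift-outside P j≢c l = All.map⁺ (All.universal (λ e (r , eq) → j≢c (proj₁ (∷-injective eq))) l)

module _ {S : Set} {ar : S → ℕ} where

  root : Term ar → Maybe S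
  root leaf       = nothing
  root (node s _) = just s

  mutual
    preorder : Term ar → List (Entry S)
    preorder leaf        = ([] , nothing) ∷ []
    preorder (node s ts) = ([] , just s) ∷ preorderV 1 ts

    preorderV : {n : ℕ} → ℕ → Vec (Term ar) n → List (Entry S)
    preorderV j []       = []
    preorderV j (t ∷ ts) = shift (j ∷ []) (preorder t) ++ preorderV (suc j) ts

  preorder-root : (t : Term ar) → ∃ λ rest → preorder t ≡ ([] , root t) ∷ rest
  preorder-root leaf        = _ , refl
  preorder-root (node s ts) = _ , refl

  mutual
    traversal-preorder : (t : Term ar) → traversal t ≡ map shape (preorder t)
    traversal-preorder leaf        = refl
    traversal-preorder (node s ts) = cong (_ ∷_) (traversalV-preorderV 1 ts)

    traversalV-preorderV : {n : ℕ} (j : ℕ) (ts : Vec (Term ar) n) →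
      traversalV j ts ≡ map shape (preorderV j ts)
    traversalV-preorderV j []       = refl
    traversalV-preorderV j (t ∷ ts) = begin
      map (map₁ (j ∷_)) (traversal t) ++ traversalV (suc j) ts
        ≡⟨ cong₂ (λ l l′ → map (map₁ (j ∷_)) l ++ l′)
                 (traversal-preorder t) (traversalV-preorderV (suc j) ts) ⟩
      map (map₁ (j ∷_)) (map shape (preorder t)) ++ map shape (preorderV (suc j) ts)
        -- map₁ (j ∷_) ∘ shape and shape ∘ map₁ (j ∷_) coincide definitionally
        ≡⟨ cong (_++ _) (trans (sym (map-∘ (preorder t))) (map-∘ (preorder t))) ⟩
      map shape (shift (j ∷ []) (preorder t)) ++ map shape (preorderV (suc j) ts)
        ≡⟨ sym (map-++ shape (shift (j ∷ []) (preorder t)) _) ⟩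
      map shape (preorderV j (t ∷ ts)) ∎
      where open ≡-Reasoning

  traversal-leaf : (t : Term ar) (k : ℕ) {x : Pos} →
    nth (traversal t) k ≡ just (x , false) → nth (preorder t) k ≡ just (x , nothing)
  traversal-leaf t k hx with nth-map⁻ shape (preorder t) k (subst (λ l → nth l k ≡ _) (traversal-preorder t) hx)
  ... | (_ , nothing) , entry , refl = entry
  ... | (_ , just _)  , _     , ()

  traversal-node : (t : Term ar) (k : ℕ) {p : Pos} →
    nth (traversal t) k ≡ just (p , true) → ∃ λ s → nth (preorder t) k ≡ just (p , just s)
  traversal-node t k hp with nth-map⁻ shape (preorder t) k (subst (λ l → nth l k ≡ _) (traversal-preorder t) hp)
  ... | (_ , just s)  , entry , refl = s , entry
  ... | (_ , nothing) , _     , ()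

  mutual
    nodes-preorder : (t : Term ar) → nodes t ≡ internal (preorder t)
    nodes-preorder leaf        = refl
    nodes-preorder (node s ts) = cong ([] ∷_) (nodesV-preorderV 1 ts)

    nodesV-preorderV : {n : ℕ} (j : ℕ) (ts : Vec (Term ar) n) → nodesV j ts ≡ internal (preorderV j ts)
    nodesV-preorderV j []       = refl
    nodesV-preorderV j (t ∷ ts) = begin
      map (j ∷_) (nodes t) ++ nodesV (suc j) ts
        ≡⟨ cong₂ (λ l l′ → map (j ∷_) l ++ l′) (nodes-preorder t) (nodesV-preorderV (suc j) ts) ⟩
      map (j ∷_) (internal (preorder t)) ++ internal (preorderV (suc j) ts)
        ≡⟨ cong (_++ _) (sym (internal-shift (j ∷ []) (preorder t))) ⟩
      internal (shift (j ∷ []) (preorder t)) ++ internal (preorderV (suc j) ts)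
        ≡⟨ sym (internal-++ (shift (j ∷ []) (preorder t)) _) ⟩
      internal (preorderV j (t ∷ ts)) ∎
      where open ≡-Reasoning

  mutual
    dc-preorder : (t : Term ar) → dc t ≡ decorations (preorder t)
    dc-preorder leaf        = refl
    dc-preorder (node s ts) = cong (s ∷_) (dcV-preorderV 1 ts)

    dcV-preorderV : {n : ℕ} (j : ℕ) (ts : Vec (Term ar) n) → dcV ts ≡ decorations (preorderV j ts)
    dcV-preorderV j []       = refl
    dcV-preorderV j (t ∷ ts) = begin
      dc t ++ dcV ts
        ≡⟨ cong₂ _++_ (dc-preorder t) (dcV-preorderV (suc j) ts) ⟩
      decorations (preorder t) ++ decorations (preorderV (suc j) ts)
        ≡⟨ cong (_++ _) (sym (decorations-shift (j ∷ []) (preorder t))) ⟩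
      decorations (shift (j ∷ []) (preorder t)) ++ decorations (preorderV (suc j) ts)
        ≡⟨ sym (decorations-++ (shift (j ∷ []) (preorder t)) _) ⟩
      decorations (preorderV j (t ∷ ts)) ∎
      where open ≡-Reasoning

  preorderV-heads : {n : ℕ} (j : ℕ) (ts : Vec (Term ar) n) → All (HeadFrom j ∘ proj₁) (preorderV j ts)
  preorderV-heads j []       = []
  preorderV-heads j (t ∷ ts) =
    All.++⁺ (All.map⁺ (All.universal (λ e → j , proj₁ e , refl , ≤-refl) (preorder t)))
            (All.map (λ { (h , q , eq , j<h) → h , q , eq , ≤-trans (n≤1+n j) j<h })
                     (preorderV-heads (suc j) ts))

  mutual
    preorder-distinct : (t : Term ar) → DistinctPositions (preorder t)
    preorder-distinct leaf        = [] ∷ []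
    preorder-distinct (node s ts) =
      All.map (λ { (h , q , eq , _) eq′ → []≢∷ (trans eq′ eq) }) (preorderV-heads 1 ts)
      ∷ preorderV-distinct 1 ts
      where []≢∷ : {h : ℕ} {q : Pos} → [] ≢ h ∷ q
            []≢∷ ()

    preorderV-distinct : {n : ℕ} (j : ℕ) (ts : Vec (Term ar) n) → DistinctPositions (preorderV j ts)
    preorderV-distinct j []       = []
    preorderV-distinct j (t ∷ ts) =
      AllPairs.++⁺ (shift-distinct (j ∷ []) (preorder-distinct t)) (preorderV-distinct (suc j) ts)
        (All.map⁺ (All.universal
          (λ e → All.map (λ head eq → HeadFrom-suc⇒≢ head (sym eq)) (preorderV-heads (suc j) ts))
          (preorder t)))

  preorderV-outside : {n : ℕ} (c : ℕ) (P : Pos) (ts : Vec (Term ar) n) →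
    All (Outside (c ∷ P)) (preorderV (suc c) ts)
  preorderV-outside c P ts = All.map (λ head (r , eq) → HeadFrom-suc⇒≢ head eq) (preorderV-heads (suc c) ts)

  subAtV-zero : {n : ℕ} (ts : Vec (Term ar) n) {P : Pos} {v : Term ar} → subAtV ts zero P ≢ just v
  subAtV-zero []      ()
  subAtV-zero (_ ∷ _) ()

  mutual
    replaceAt-subAt : (t : Term ar) (P : Pos) {v : Term ar} → subAt t P ≡ just v → replaceAt t P v ≡ t
    replaceAt-subAt t           []      refl = refl
    replaceAt-subAt leaf        (_ ∷ _) ()
    replaceAt-subAt (node s ts) (c ∷ P) eq   = cong (node s) (replaceAtV-subAtV ts c P eq)

    replaceAtV-subAtV : {n : ℕ} (ts : Vec (Term ar) n) (c : ℕ) (P : Pos) {v : Term ar} →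
      subAtV ts c P ≡ just v → replaceAtV ts c P v ≡ ts
    replaceAtV-subAtV []       c             P ()
    replaceAtV-subAtV (t ∷ ts) zero          P ()
    replaceAtV-subAtV (t ∷ ts) (suc zero)    P eq = cong (_∷ ts) (replaceAt-subAt t P eq)
    replaceAtV-subAtV (t ∷ ts) (suc (suc c)) P eq = cong (t ∷_) (replaceAtV-subAtV ts (suc c) P eq)

  mutual
    subAt-parent : (t : Term ar) (Q : Pos) (c : ℕ) {v : Term ar} → subAt t (Q ∷ʳ c) ≡ just v →
      1 ≤ c × ∃₂ λ s ts → subAt t Q ≡ just (node s ts)
    subAt-parent leaf        []      c       ()
    subAt-parent (node s ts) []      zero    eq = ⊥-elim (subAtV-zero ts eq)
    subAt-parent (node s ts) []      (suc c) eq = s≤s z≤n , s , ts , refl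
    subAt-parent leaf        (q ∷ Q) c       ()
    subAt-parent (node s ts) (q ∷ Q) c       eq = subAtV-parent ts q Q c eq

    subAtV-parent : {n : ℕ} (ts : Vec (Term ar) n) (q : ℕ) (Q : Pos) (c : ℕ) {v : Term ar} →
      subAtV ts q (Q ∷ʳ c) ≡ just v → 1 ≤ c × ∃₂ λ s ts′ → subAtV ts q Q ≡ just (node s ts′)
    subAtV-parent []       q             Q c ()
    subAtV-parent (t ∷ ts) zero          Q c ()
    subAtV-parent (t ∷ ts) (suc zero)    Q c eq = subAt-parent t Q c eq
    subAtV-parent (t ∷ ts) (suc (suc q)) Q c eq = subAtV-parent ts (suc q) Q c eq

  mutual
    ∈-preorder⇒subAt : (t : Term ar) {P : Pos} {m : Maybe S} → (P , m) ∈ preorder t →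
      ∃ λ v → subAt t P ≡ just v × root v ≡ m
    ∈-preorder⇒subAt leaf        (here refl) = leaf , refl , refl
    ∈-preorder⇒subAt (node s ts) (here refl) = node s ts , refl , refl
    ∈-preorder⇒subAt (node s ts) (there e∈)  with ∈-preorderV⇒subAtV 1 ts e∈
    ... | k , P′ , refl , found = found

    -- The vector holds the children numbered j, j + 1, …, whereas subAtV counts from 1.
    ∈-preorderV⇒subAtV : {n : ℕ} (j : ℕ) (ts : Vec (Term ar) n) {P : Pos} {m : Maybe S} →
      (P , m) ∈ preorderV j ts →
      ∃₂ λ k P′ → P ≡ (j + k) ∷ P′ × ∃ λ v → subAtV ts (suc k) P′ ≡ just v × root v ≡ m
    ∈-preorderV⇒subAtV j (t ∷ ts) e∈ with ∈-++⁻ (shift (j ∷ []) (preorder t)) e∈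
    ... | inj₁ e∈t with ∈-map⁻ (map₁ ((j ∷ []) ++_)) e∈t
    ...   | (P₀ , m₀) , e∈t′ , refl =
      0 , P₀ , cong (_∷ P₀) (sym (+-identityʳ j)) , ∈-preorder⇒subAt t e∈t′
    ∈-preorderV⇒subAtV j (t ∷ ts) e∈ | inj₂ e∈ts with ∈-preorderV⇒subAtV (suc j) ts e∈ts
    ... | k , P′ , refl , found = suc k , P′ , cong (_∷ P′) (sym (+-suc j k)) , found

  -- Focus P f B A: f plugs a term into a one-hole context whose hole sits at position P;
  -- B and A are the traversal entries of the context before and after the hole.
  record Focus (P : Pos) (f : Term ar → List (Entry S)) (B A : List (Entry S)) : Set where
    field
      plug           : ∀ w → f w ≡ B ++ shift P (preorder w) ++ A
      before-outside : All (Outside P) B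
      after-outside  : All (Outside P) A

  open Focus

  focus-here : Focus [] preorder [] []
  focus-here = record
    { plug           = λ w → sym (trans (++-identityʳ _) (map-id (preorder w)))
    ; before-outside = []
    ; after-outside  = []
    }

  focus-prepend : {P : Pos} {f : Term ar → List (Entry S)} {B A : List (Entry S)} (xs : List (Entry S)) →
    All (Outside P) xs → Focus P f B A → Focus P (λ w → xs ++ f w) (xs ++ B) A
  focus-prepend xs out F = record
    { plug           = λ w → trans (cong (xs ++_) (plug F w)) (sym (++-assoc xs _ _))
    ; before-outside = All.++⁺ out (before-outside F)
    ; after-outside  = after-outside F
    }

  focus-append : {P : Pos} {f : Term ar → List (Entry S)} {B A : List (Entry S)} (ys : List (Entry S)) →
    All (Outside P) ys → Focus P f B A → Focus P (λ w → f w ++ ys) B (A ++ ys)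
  focus-append {P} {B = B} {A} ys out F = record
    { plug           = λ w → begin
        _ ++ ys                                  ≡⟨ cong (_++ ys) (plug F w) ⟩
        (B ++ shift P (preorder w) ++ A) ++ ys   ≡⟨ ++-assoc B _ ys ⟩
        B ++ (shift P (preorder w) ++ A) ++ ys   ≡⟨ cong (B ++_) (++-assoc (shift P (preorder w)) A ys) ⟩
        B ++ shift P (preorder w) ++ A ++ ys     ∎
    ; before-outside = before-outside F
    ; after-outside  = All.++⁺ (after-outside F) out
    }
    where open ≡-Reasoning

  focus-shift : {P : Pos} {f : Term ar → List (Entry S)} {B A : List (Entry S)} (j : ℕ) →
    Focus P f B A → Focus (j ∷ P) (λ w → shift (j ∷ []) (f w)) (shift (j ∷ []) B) (shift (j ∷ []) A)
  focus-shift {P} {f} {B} {A} j F = record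
    { plug           = λ w → begin
        sj (f w)                                   ≡⟨ cong sj (plug F w) ⟩
        sj (B ++ shift P (preorder w) ++ A)        ≡⟨ map-++ _ B _ ⟩
        sj B ++ sj (shift P (preorder w) ++ A)     ≡⟨ cong (sj B ++_) (map-++ _ (shift P (preorder w)) A) ⟩
        sj B ++ sj (shift P (preorder w)) ++ sj A  ≡⟨ cong (λ l → sj B ++ l ++ sj A) (sym (map-∘ (preorder w))) ⟩
        sj B ++ shift (j ∷ P) (preorder w) ++ sj A ∎
    ; before-outside = All.map⁺ (All.map (λ {e} → lift {e}) (before-outside F))
    ; after-outside  = All.map⁺ (All.map (λ {e} → lift {e}) (after-outside F))
    }
    where
      open ≡-Reasoning

      sj : List (Entry S) → List (Entry S)
      sj = shift (j ∷ [])

      lift : {e : Entry S} → Outside P e → Outside (j ∷ P) (map₁ ((j ∷ []) ++_) e)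
      lift out (r , eq) = out (r , ∷-injectiveʳ eq)

  focus-at : {P Q : Pos} {f : Term ar → List (Entry S)} {B A : List (Entry S)} →
    P ≡ Q → Focus P f B A → Focus Q f B A
  focus-at refl F = F

  mutual
    focus : (t : Term ar) (P : Pos) {v : Term ar} → subAt t P ≡ just v →
      ∃₂ λ B A → Focus P (λ w → preorder (replaceAt t P w)) B A
    focus t           []          _  = [] , [] , focus-here
    focus leaf        (_ ∷ _)     ()
    focus (node s ts) (zero ∷ P)  eq = ⊥-elim (subAtV-zero ts eq)
    focus (node s ts) (suc k ∷ P) eq with focusV 1 ts k P eq
    ... | B , A , F = _ , A , focus-prepend (([] , just s) ∷ []) ((λ { (_ , ()) }) ∷ []) F

    focusV : {n : ℕ} (j : ℕ) (ts : Vec (Term ar) n) (k : ℕ) (P : Pos) {v : Term ar} →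
      subAtV ts (suc k) P ≡ just v →
      ∃₂ λ B A → Focus ((j + k) ∷ P) (λ w → preorderV j (replaceAtV ts (suc k) P w)) B A
    focusV j []       k       P ()
    focusV j (t ∷ ts) zero    P eq with focus t P eq
    ... | B , A , F = _ , _ , focus-at (cong (_∷ P) (sym (+-identityʳ j)))
                                (focus-append _ (preorderV-outside j P ts) (focus-shift j F))
    focusV j (t ∷ ts) (suc k) P eq with focusV (suc j) ts k P eq
    ... | B , A , F = _ , A , focus-at (cong (_∷ P) (sym (+-suc j k)))
                                (focus-prepend _ (shift-outside P (m≢1+m+n j) (preorder t)) F)

  preorder-focused : (t : Term ar) (P : Pos) {u : Term ar} {B A : List (Entry S)} → subAt t P ≡ just u →
    Focus P (λ w → preorder (replaceAt t P w)) B A → preorder t ≡ B ++ shift P (preorder u) ++ A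
  preorder-focused t P at F = trans (cong preorder (sym (replaceAt-subAt t P at))) (plug F _)

  subAt⇒∈-preorder : (t : Term ar) (P : Pos) {v : Term ar} → subAt t P ≡ just v →
    (P , root v) ∈ preorder t
  subAt⇒∈-preorder t P {v} at with focus t P at | preorder-root v
  ... | B , A , F | rest , pre-v =
    subst ((P , root v) ∈_) (sym (trans (preorder-focused t P at F) (cong (λ l → B ++ shift P l ++ A) pre-v)))
          (∈-++⁺ʳ B (here (cong (_, root v) (sym (++-identityʳ P)))))

  preorder-parent : (t : Term ar) (Q : Pos) (c : ℕ) {m : Maybe S} → (Q ∷ʳ c , m) ∈ preorder t →
    1 ≤ c × ∃ λ n → nth (nodes t) n ≡ just Q
  preorder-parent t Q c e∈ with ∈-preorder⇒subAt t e∈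
  ... | _ , at , _ with subAt-parent t Q c at
  ...   | 1≤c , _ , _ , atQ =
    1≤c , ∈-nth (subst (Q ∈_) (sym (nodes-preorder t)) (∈-internal (preorder t) (subAt⇒∈-preorder t Q atQ)))

  nodesV-heads : {n : ℕ} (j : ℕ) (ts : Vec (Term ar) n) → All (HeadFrom j) (nodesV j ts)
  nodesV-heads j ts =
    subst (All (HeadFrom j)) (sym (nodesV-preorderV j ts)) (All-internal _ (preorderV-heads j ts))

  preorderV-first : {n : ℕ} (j : ℕ) (ts : Vec (Term ar) n) {e : Entry S} →
    nth (preorderV j ts) 0 ≡ just e → proj₁ e ≡ j ∷ []
  preorderV-first j (leaf ∷ ts)     refl = refl
  preorderV-first j (node _ _ ∷ ts) refl = refl

  mutual
    preorder-leaf-node : (t : Term ar) (k : ℕ) {x p : Pos} {s : S} →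
      nth (preorder t) k ≡ just (x , nothing) → nth (preorder t) (suc k) ≡ just (p , just s) →
      InLeftSibling x p
    preorder-leaf-node leaf        zero    _  ()
    preorder-leaf-node leaf        (suc k) () _
    preorder-leaf-node (node s ts) zero    () _
    preorder-leaf-node (node s ts) (suc k) hx hp = preorderV-leaf-node 1 ts k hx hp

    preorderV-leaf-node : {n : ℕ} (j : ℕ) (ts : Vec (Term ar) n) (k : ℕ) {x p : Pos} {s : S} →
      nth (preorderV j ts) k ≡ just (x , nothing) → nth (preorderV j ts) (suc k) ≡ just (p , just s) →
      InLeftSibling x p
    preorderV-leaf-node j (t ∷ ts) k hx hp
      with nth-++-consecutive (shift (j ∷ []) (preorder t)) (preorderV (suc j) ts) k hx hp
    ... | inj₁ (hx′ , hp′)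
      with nth-map⁻ _ (preorder t) k hx′ | nth-map⁻ _ (preorder t) (suc k) hp′
    ...   | _ , hx₀ , refl | _ , hp₀ , refl with preorder-leaf-node t k hx₀ hp₀
    ...     | q , b , r , refl , refl = j ∷ q , b , r , refl , refl
    preorderV-leaf-node j (t ∷ ts) k hx hp | inj₂ (inj₁ (hx′ , hp′))
      with nth-map⁻ _ (preorder t) k hx′ | preorderV-first (suc j) ts hp′
    ... | (x₀ , _) , _ , refl | refl = [] , j , x₀ , refl , refl
    preorderV-leaf-node j (t ∷ ts) k hx hp | inj₂ (inj₂ (m , hx′ , hp′)) =
      preorderV-leaf-node (suc j) ts m hx′ hp′

  mutual
    nodes-prefix-< : (t : Term ar) (a c : ℕ) {P : Pos} {d : ℕ} {e : Pos} →
      nth (nodes t) a ≡ just P → nth (nodes t) c ≡ just (P ++ d ∷ e) → a < c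
    nodes-prefix-< leaf        a       c       () _
    nodes-prefix-< (node s ts) a       zero    {[]}    _ ()
    nodes-prefix-< (node s ts) a       zero    {_ ∷ _} _ ()
    nodes-prefix-< (node s ts) zero    (suc c) _  _  = s≤s z≤n
    nodes-prefix-< (node s ts) (suc a) (suc c) ha hc = s≤s (nodesV-prefix-< 1 ts a c ha hc)

    nodesV-prefix-< : {n : ℕ} (j : ℕ) (ts : Vec (Term ar) n) (a c : ℕ) {P : Pos} {d : ℕ} {e : Pos} →
      nth (nodesV j ts) a ≡ just P → nth (nodesV j ts) c ≡ just (P ++ d ∷ e) → a < c
    nodesV-prefix-< j (t ∷ ts) a c ha hc
      with nth-++⁻ (map (j ∷_) (nodes t)) (nodesV (suc j) ts) a ha
         | nth-++⁻ (map (j ∷_) (nodes t)) (nodesV (suc j) ts) c hc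
    ... | inj₁ ha′ | inj₁ hc′ with nth-map⁻ (j ∷_) (nodes t) a ha′ | nth-map⁻ (j ∷_) (nodes t) c hc′
    ...   | _ , ha₀ , refl | _ , hc₀ , eq =
      nodes-prefix-< t a c ha₀ (subst (λ Q → nth (nodes t) c ≡ just Q) (∷-injectiveʳ eq) hc₀)
    nodesV-prefix-< j (t ∷ ts) a c ha hc | inj₁ ha′ | inj₂ (m , refl , _) =
      ≤-trans (nth-length (map (j ∷_) (nodes t)) a ha′) (m≤m+n _ m)
    nodesV-prefix-< j (t ∷ ts) a c {P} {d} {e} ha hc | inj₂ (m , refl , ha′) | inj₁ hc′
      with nth-map⁻ (j ∷_) (nodes t) c hc′
    ... | _ , _ , eq = ⊥-elim (HeadFrom-suc⇒≢ (HeadFrom-++ (d ∷ e) P-head) (sym eq))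
      where
        P-head : HeadFrom (suc j) P
        P-head = All.lookup (nodesV-heads (suc j) ts) (nth-∈ _ m ha′)
    nodesV-prefix-< j (t ∷ ts) a c ha hc | inj₂ (m , refl , ha′) | inj₂ (m′ , refl , hc′) =
      +-monoʳ-< (length (map (j ∷_) (nodes t))) (nodesV-prefix-< (suc j) ts m m′ ha′ hc′)

  -- Moving a subtree onto a leaf

  focus-split : (t : Term ar) (P : Pos) {u : Term ar} {B A C D : List (Entry S)} {m : Maybe S} →
    subAt t P ≡ just u → Focus P (λ w → preorder (replaceAt t P w)) B A →
    preorder t ≡ C ++ (P , m) ∷ D → B ≡ C × shift P (preorder u) ++ A ≡ (P , m) ∷ D
  focus-split t P {u} {B} {A} {C} at F split with preorder-root u
  ... | rest , pre-u
    with split-unique proj₁ (preorder-distinct t) B C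
           (trans (preorder-focused t P at F) (cong (λ l → B ++ shift P l ++ A) pre-u)) split (++-identityʳ P)
  ... | refl , eq , refl = refl , trans (cong (λ l → shift P l ++ A) pre-u) (cong (_∷ shift P rest ++ A) eq)

  leaf-focus : (t : Term ar) (x : Pos) {C D : List (Entry S)} → preorder t ≡ C ++ (x , nothing) ∷ D →
    Focus x (λ w → preorder (replaceAt t x w)) C D
  leaf-focus t x {C} split
    with ∈-preorder⇒subAt t (subst ((x , nothing) ∈_) (sym split) (∈-++⁺ʳ C (here refl)))
  ... | node _ _ , _  , ()
  ... | leaf     , at , _ with focus t x at
  ...   | B , A , F with focus-split t x at F split
  ...     | refl , eq with ∷-injectiveʳ eq
  ...       | refl = F

  record Regraft (t₁ t₂ : Term ar) (x p : Pos) : Set where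
    field
      before moved after : List (Entry S)
      preorder₁        : preorder t₁ ≡ before ++ (x , nothing) ∷ shift p moved ++ after
      preorder₂        : preorder t₂ ≡ before ++ shift x moved ++ (p ++ [] , nothing) ∷ after
      before-outside-p : All (Outside p) before
      after-outside-p  : All (Outside p) after
      before-outside-x : All (Outside x) before
      after-outside-x  : All (Outside x) after
      x-outside-p      : ¬ p ≼ x

  rotation-regraft : (t₁ : Term ar) (k : ℕ) {x p : Pos} {s : S} {u : Term ar} →
    nth (preorder t₁) k ≡ just (x , nothing) → nth (preorder t₁) (suc k) ≡ just (p , just s) →
    subAt t₁ p ≡ just u → Regraft t₁ (replaceAt (replaceAt t₁ p leaf) x u) x p
  rotation-regraft t₁ k {x} {p} {u = u} hx hp at with nth-split₂ (preorder t₁) k hx hp | focus t₁ p at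
  ... | C , D , adjacent | B , A , F
    with focus-split t₁ p at F (trans adjacent (sym (++-assoc C ((x , nothing) ∷ []) _)))
  ... | refl , _ = record
    { before           = C
    ; moved            = preorder u
    ; after            = A
    ; preorder₁        = trans (preorder-focused t₁ p at F) (++-assoc C _ _)
    ; preorder₂        = plug G u
    ; before-outside-p = proj₁ (All.∷ʳ⁻ (before-outside F))
    ; after-outside-p  = after-outside F
    ; before-outside-x = before-outside G
    ; after-outside-x  = All.tail (after-outside G)
    ; x-outside-p      = proj₂ (All.∷ʳ⁻ (before-outside F))
    }
    where
      G : Focus x (λ w → preorder (replaceAt (replaceAt t₁ p leaf) x w)) C ((p ++ [] , nothing) ∷ A)
      G = leaf-focus (replaceAt t₁ p leaf) x (trans (plug F leaf) (++-assoc C _ _))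

  module _ {t₁ t₂ : Term ar} {x p : Pos} (R : Regraft t₁ t₂ x p) where

    open Regraft R

    regraft-dc : dc t₁ ≡ dc t₂
    regraft-dc = begin
      dc t₁
        ≡⟨ dc-preorder t₁ ⟩
      decorations (preorder t₁)
        ≡⟨ cong decorations preorder₁ ⟩
      decorations (before ++ (x , nothing) ∷ shift p moved ++ after)
        ≡⟨ decorations-++ before _ ⟩
      decorations before ++ decorations (shift p moved ++ after)
        ≡⟨ cong (decorations before ++_) (decorations-shift-++ p moved after) ⟩
      decorations before ++ decorations moved ++ decorations after
        ≡⟨ cong (decorations before ++_) (sym (decorations-shift-++ x moved _)) ⟩
      decorations before ++ decorations (shift x moved ++ (p ++ [] , nothing) ∷ after)
        ≡⟨ sym (decorations-++ before _) ⟩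
      decorations (before ++ shift x moved ++ (p ++ [] , nothing) ∷ after)
        ≡⟨ cong decorations (sym preorder₂) ⟩
      decorations (preorder t₂)
        ≡⟨ sym (dc-preorder t₂) ⟩
      dc t₂ ∎
      where open ≡-Reasoning

    regraft-nodes₁ : nodes t₁ ≡ internal before ++ map (p ++_) (internal moved) ++ internal after
    regraft-nodes₁ = begin
      nodes t₁
        ≡⟨ nodes-preorder t₁ ⟩
      internal (preorder t₁)
        ≡⟨ cong internal preorder₁ ⟩
      internal (before ++ (x , nothing) ∷ shift p moved ++ after)
        ≡⟨ internal-++ before _ ⟩
      internal before ++ internal (shift p moved ++ after)
        ≡⟨ cong (internal before ++_) (internal-shift-++ p moved after) ⟩
      internal before ++ map (p ++_) (internal moved) ++ internal after ∎
      where open ≡-Reasoning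

    regraft-nodes₂ : nodes t₂ ≡ internal before ++ map (x ++_) (internal moved) ++ internal after
    regraft-nodes₂ = begin
      nodes t₂
        ≡⟨ nodes-preorder t₂ ⟩
      internal (preorder t₂)
        ≡⟨ cong internal preorder₂ ⟩
      internal (before ++ shift x moved ++ (p ++ [] , nothing) ∷ after)
        ≡⟨ internal-++ before _ ⟩
      internal before ++ internal (shift x moved ++ (p ++ [] , nothing) ∷ after)
        ≡⟨ cong (internal before ++_) (internal-shift-++ x moved _) ⟩
      internal before ++ map (x ++_) (internal moved) ++ internal after ∎
      where open ≡-Reasoning

    regraft-relocates : Pointwise (Relocated p x) (nodes t₁) (nodes t₂)
    regraft-relocates = subst₂ (Pointwise (Relocated p x)) (sym regraft-nodes₁) (sym regraft-nodes₂)
      (relocate p x (All-internal before before-outside-p) (All-internal after after-outside-p) (internal moved))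

    regraft-relocates⁻ : Pointwise (Relocated x p) (nodes t₂) (nodes t₁)
    regraft-relocates⁻ = subst₂ (Pointwise (Relocated x p)) (sym regraft-nodes₂) (sym regraft-nodes₁)
      (relocate x p (All-internal before before-outside-x) (All-internal after after-outside-x) (internal moved))

  -- Edges and descendants

  nodes-unique : (t : Term ar) → Unique (nodes t)
  nodes-unique t = subst Unique (sym (nodes-preorder t)) (internal-unique _ (preorder-distinct t))

  nodeAt-relocated : {R : Pos → Pos → Set} {t t′ : Term ar} → Pointwise R (nodes t) (nodes t′) →
    (n : ℕ) {P : Pos} → nodeAt t n ≡ just P → ∃ λ P′ → nodeAt t′ n ≡ just P′ × R P P′
  nodeAt-relocated rel zero    ()
  nodeAt-relocated rel (suc n) eq = nth-Pointwise rel n eq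

  nodeAt-injective : {t : Term ar} → Unique (nodes t) → (m n : ℕ) {P : Pos} →
    nodeAt t m ≡ just P → nodeAt t n ≡ just P → m ≡ n
  nodeAt-injective distinct (suc m) (suc n) eqm eqn = cong suc (nth-injective distinct m n eqm eqn)

  nodeAt-root : (t : Term ar) {P : Pos} → nodeAt t 1 ≡ just P → P ≡ []
  nodeAt-root (node s ts) refl = refl

  edge-unique : (t : Term ar) → Unique (nodes t) → {i₁ j i₁′ j′ i : ℕ} →
    Edge t i₁ j i → Edge t i₁′ j′ i → i₁ ≡ i₁′ × j ≡ j′
  edge-unique t _ (inj₁ (_ , refl , refl , refl)) (inj₁ (_ , refl , refl , refl)) = refl , refl
  edge-unique t _ (inj₁ (_ , refl , refl , refl)) (inj₂ (_ , P , _ , hc)) =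
    ⊥-elim (∷ʳ≢[] P (nodeAt-root t hc))
  edge-unique t _ (inj₂ (_ , P , _ , hc)) (inj₁ (_ , refl , refl , refl)) =
    ⊥-elim (∷ʳ≢[] P (nodeAt-root t hc))
  edge-unique t distinct (inj₂ (_ , P , hP , hc)) (inj₂ (_ , P′ , hP′ , hc′))
    with ∷ʳ-injective P P′ (just-injective (trans (sym hc) hc′))
  ... | refl , refl = nodeAt-injective distinct _ _ hP hP′ , refl

  edge-relocate : {t t′ : Term ar} {p x : Pos} {i : ℕ} → Pointwise (Relocated p x) (nodes t) (nodes t′) →
    Unique (nodes t) → nodeAt t i ≡ just p → {i₁ j i₂ : ℕ} → Edge t i₁ j i₂ → i₂ ≢ i → Edge t′ i₁ j i₂
  edge-relocate rel _ _ (inj₁ (nonempty , root-edge)) _ =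
    inj₁ (subst (1 ≤_) (Pointwise.Pointwise-length rel) nonempty , root-edge)
  edge-relocate {p = p} {x} {i} rel distinct hp {i₁} {j} {i₂} (inj₂ (1≤j , P , hP , hc)) i₂≢i
    with nodeAt-relocated rel i₂ hc | nodeAt-relocated rel i₁ hP
  ... | _ , hc′ , inj₂ (refl , p⋠Pj) | _ , hP′ , relP =
    inj₂ (1≤j , P , trans hP′ (cong just (relocated-fixed (p⋠Pj ∘ ≼-++ (j ∷ [])) relP)) , hc′)
  ... | _ , hc′ , inj₁ (r , eq , refl) | _ , hP′ , relP with initLast r
  ...   | [] =
    ⊥-elim (i₂≢i (nodeAt-injective distinct i₂ i (trans hc (cong just (trans eq (++-identityʳ p)))) hp))
  ...   | r′ ∷ʳ′ c with ∷ʳ-injective P (p ++ r′) (trans eq (sym (++-assoc p r′ (c ∷ []))))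
  ...     | refl , refl =
    inj₂ (1≤j , x ++ r′ , trans hP′ (cong just (relocated-moved relP)) ,
          trans hc′ (cong just (sym (++-assoc x r′ (c ∷ [])))))

  non-parent-edge-relocate : {t t′ : Term ar} {p x : Pos} {i a b a′ b′ : ℕ} →
    Pointwise (Relocated p x) (nodes t) (nodes t′) → nodeAt t i ≡ just p → Edge t a b i →
    (i₁ j i₂ : ℕ) → Edge t i₁ j i₂ × ¬ ((i₁ , j , i₂) ≡ (a , b , i)) →
    Edge t′ i₁ j i₂ × ¬ ((i₁ , j , i₂) ≡ (a′ , b′ , i))
  non-parent-edge-relocate {t} {i = i} rel hp parent i₁ j i₂ (edge , not-parent) =
    edge-relocate rel (nodes-unique t) hp edge i₂≢i , λ eq → i₂≢i (cong (proj₂ ∘ proj₂) eq)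
    where
      i₂≢i : i₂ ≢ i
      i₂≢i refl with edge-unique t (nodes-unique t) edge parent
      ... | refl , refl = not-parent refl

  parent-edges-dominated : (t : Term ar) {a a′ b c : ℕ} {q q′ r : Pos} →
    nth (nodes t) a ≡ just q → nth (nodes t) a′ ≡ just q′ → q′ ∷ʳ c ≡ q ++ b ∷ r →
    Dominated (suc a , suc b) (suc a′ , c)
  parent-edges-dominated t {a} {a′} {b} {q = q} {q′} {r} hq hq′ eq with initLast r
  ... | [] with ∷ʳ-injective q′ q eq
  ...   | refl , refl = inj₂ (cong suc (nth-injective (nodes-unique t) a a′ hq hq′) , n≤1+n b)
  parent-edges-dominated t {a} {a′} {b} {q = q} {q′} hq hq′ eq | r′ ∷ʳ′ d
    with ∷ʳ-injective q′ (q ++ b ∷ r′) (trans eq (sym (++-assoc q (b ∷ r′) (d ∷ []))))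
  ... | refl , _ = inj₁ (s≤s (nodes-prefix-< t a a′ hq hq′))

  descendant-relocate : {t t′ : Term ar} {p x : Pos} → Pointwise (Relocated p x) (nodes t) (nodes t′) →
    (∀ {P} → P ≼ p → ¬ p ≼ P → P ≼ x) → (a c : ℕ) → Descendant t a c → Descendant t′ a c
  descendant-relocate {p = p} {x} rel strict a c (P , Q , hP , hc)
    with nodeAt-relocated rel a hP | nodeAt-relocated rel c hc
  ... | _ , hP′ , inj₁ (r , refl , refl) | _ , hc′ , relc =
    x ++ r , Q , hP′ ,
    trans hc′ (cong just (trans (relocated-moved (subst (λ P → Relocated p x P _) (++-assoc p r Q) relc))
                                (sym (++-assoc x r Q))))
  ... | _ , hP′ , inj₂ (refl , _) | _ , hc′ , inj₂ (refl , _) = P , Q , hP′ , hc′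
  ... | _ , hP′ , inj₂ (refl , p⋠P) | _ , hc′ , inj₁ (r , eq , refl) with ≼-comparable P p Q r eq
  ...   | inj₂ p≼P = ⊥-elim (p⋠P p≼P)
  ...   | inj₁ P≼p with strict P≼p p⋠P
  ...     | w , refl = P , w ++ r , hP′ , trans hc′ (cong just (++-assoc P w r))

  OnlyParentEdgeMoves : Term ar → Term ar → ℕ → Set
  OnlyParentEdgeMoves t₁ t₂ i =
    Σ ℕ λ a₁ → Σ ℕ λ b₁ → Σ ℕ λ a₂ → Σ ℕ λ b₂ →
      Edge t₁ a₁ b₁ i × Edge t₂ a₂ b₂ i
      × (∀ i₁ j i₂ →
           (Edge t₁ i₁ j i₂ × ¬ ((i₁ , j , i₂) ≡ (a₁ , b₁ , i)))
           ⇔ (Edge t₂ i₁ j i₂ × ¬ ((i₁ , j , i₂) ≡ (a₂ , b₂ , i))))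
      × Dominated (a₁ , b₁) (a₂ , b₂)

  regraft-edges : {t₁ t₂ : Term ar} {x p : Pos} {i : ℕ} {s : S} → Regraft t₁ t₂ x p →
    nodeAt t₁ i ≡ just p → InLeftSibling x p → (p , just s) ∈ preorder t₁ → (x , nothing) ∈ preorder t₁ →
    OnlyParentEdgeMoves t₁ t₂ i
  regraft-edges {x = x} R hi (q , b , r , refl , x≡) p∈ x∈ with initLast x
  ... | [] with ++-conicalʳ q (b ∷ r) (sym x≡)
  ...   | ()
  regraft-edges {t₁} {t₂} {i = i} R hi (q , b , r , refl , x≡) p∈ x∈ | q′ ∷ʳ′ c
    with preorder-parent t₁ q (suc b) p∈ | preorder-parent t₁ q′ c x∈
  ... | _ , a₁ , hq | 1≤c , a₂ , hq′ =
    suc a₁ , suc b , suc a₂ , c , parent₁ , parent₂ ,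
    (λ i₁ j i₂ → mk⇔ (non-parent-edge-relocate (regraft-relocates R) hi parent₁ i₁ j i₂)
                     (non-parent-edge-relocate (regraft-relocates⁻ R) hi₂ parent₂ i₁ j i₂)) ,
    parent-edges-dominated t₁ hq hq′ x≡
    where
      hi₂ : nodeAt t₂ i ≡ just (q′ ∷ʳ c)
      hi₂ with nodeAt-relocated (regraft-relocates R) i hi
      ... | _ , h , relocation = trans h (cong just (relocated-self relocation))

      hq′₂ : nodeAt t₂ (suc a₂) ≡ just q′
      hq′₂ with nodeAt-relocated (regraft-relocates R) (suc a₂) hq′
      ... | _ , h , relocation =
        trans h (cong just (relocated-fixed (Regraft.x-outside-p R ∘ ≼-++ (c ∷ [])) relocation))

      parent₁ : Edge t₁ (suc a₁) (suc b) i
      parent₁ = inj₂ (s≤s z≤n , q , hq , hi)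

      parent₂ : Edge t₂ (suc a₂) c i
      parent₂ = inj₂ (1≤c , q′ , hq′₂ , hi₂)

lemma2p2p1 : {S : Set} (ar : S → ℕ) (t₁ t₂ : Term ar) (i : ℕ) →
  2 ≤ i → Rot t₁ i t₂ →
  (dc t₁ ≡ dc t₂)
  × (Σ ℕ λ a₁ → Σ ℕ λ b₁ → Σ ℕ λ a₂ → Σ ℕ λ b₂ →
       Edge t₁ a₁ b₁ i × Edge t₂ a₂ b₂ i
       × (∀ i₁ j i₂ →
            (Edge t₁ i₁ j i₂ × ¬ ((i₁ , j , i₂) ≡ (a₁ , b₁ , i)))
            ⇔ (Edge t₂ i₁ j i₂ × ¬ ((i₁ , j , i₂) ≡ (a₂ , b₂ , i))))
       × Dominated (a₁ , b₁) (a₂ , b₂))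
  × (∀ i' i'' → Descendant t₁ i' i'' → Descendant t₂ i' i'')
lemma2p2p1 ar t₁ _ i _ (k , x , p , u , hx , hp , hi , hu , refl) =
  regraft-dc R ,
  regraft-edges R hi sibling (nth-∈ _ (suc k) node-entry) (nth-∈ _ k leaf-entry) ,
  descendant-relocate (regraft-relocates R) (strict-prefix-of-left-sibling sibling)
  where
    leaf-entry : nth (preorder t₁) k ≡ just (x , nothing)
    leaf-entry = traversal-leaf t₁ k hx

    node-entry : nth (preorder t₁) (suc k) ≡ just (p , just (proj₁ (traversal-node t₁ (suc k) hp)))
    node-entry = proj₂ (traversal-node t₁ (suc k) hp)

    R : Regraft t₁ (replaceAt (replaceAt t₁ p leaf) x u) x p
    R = rotation-regraft t₁ k leaf-entry node-entry hu

    sibling : InLeftSibling x p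
    sibling = preorder-leaf-node t₁ k leaf-entry node-entry
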